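{- Let $a,b\in\mathbb Z$ with $\gcd(a,b)=1$ and let $t\in\mathbb N=\{1,2,3,\dots\}$. Then $$\#\{(x,y)\in \mathbb Z^2:\ ax+by\in[1,\,t(a^2+b^2)-1]\ \text{and}\ ay-bx \in [1,\,t(a^2+b^2)-1] \}=(a^2+b^2)t^2-2t+1.$$ -}

module Defs where

open import Data.Integer using (ℤ; +_; _+_; _-_; _*_; _≤_)
open import Data.Nat using (ℕ)
open import Data.Product using (Σ; _×_)

InInterval : ℤ → ℤ → ℤ → Set
InInterval lo hi z = (lo ≤ z) × (z ≤ hi)

upper : ℤ → ℤ → ℕ → ℤ
upper a b t = (+ t) * (a * a + b * b) - + 1

Pts : ℤ → ℤ → ℕ → Set
Pts a b t = Σ (ℤ × ℤ) λ p →
  let x = Data.Product.proj₁ p ; y = Data.Product.proj₂ p in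
  InInterval (+ 1) (upper a b t) (a * x + b * y) ×
  InInterval (+ 1) (upper a b t) (a * y - b * x)

-- Since gcd(a, b) = 1 there are p, q with ap + bq = 1, and the unimodular substitution
-- u = ax + by, w = -qx + py turns the points into the pairs (u, w) with u and
-- v = ay - bx = cu + nw in [1, tn - 1], where n = a² + b² and c = aq - bp; thus v runs
-- over the residue class of cu modulo n. Writing u = ni + j with 0 ≤ j < n, the class of v
-- is ρ(j) = cj mod n, and as c² ≡ -1 (mod n), ρ(j) = 0 only for j = 0. A nonzero residue
-- class meets [1, tn - 1] in t integers and the zero class in t - 1, so the number of
-- points is (t - 1)² + (n - 1)t² = nt² - 2t + 1.
module Submission where

open import Data.Fin using (Fin; toℕ; fromℕ<; zero; suc)
open import Data.Fin.Properties using (toℕ<n; toℕ-fromℕ<; toℕ-injective; 0≢1+n; +↔⊎; *↔×)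
open import Data.Integer using (ℤ; +_; -[1+_]; _+_; _-_; _*_; -_; _≤_; _<_; +≤+; +<+; 0ℤ; 1ℤ; -1ℤ; ∣_∣)
open import Data.Integer.DivMod using (_/ℕ_; _%ℕ_; n%ℕd<d; a≡a%ℕn+[a/ℕn]*n)
open import Data.Integer.GCD using (gcd)
import Data.Integer.Properties as ℤ
open import Data.Integer.Tactic.RingSolver using (solve-∀)
open import Data.Nat using (ℕ; NonZero)
import Data.Nat as ℕ
open import Data.Nat.GCD using (GCD; gcd-GCD; module Bézout)
import Data.Nat.Properties as ℕ
open import Data.Product using (Σ; _×_; _,_; proj₁; proj₂)
import Data.Product.Function.Dependent.Propositional as Σ
open import Data.Product.Function.NonDependent.Propositional using (_×-⇔_; _×-↔_)
open import Data.Sum using (_⊎_; inj₁; inj₂)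
open import Data.Sum.Function.Propositional using (_⊎-↔_)
open import Function using (_∘_)
open import Function.Bundles using (_↔_; _⇔_; mk↔ₛ′; mk⇔; Equivalence)
open import Function.Properties.Inverse using (↔-refl; ↔-trans)
import Function.Related.Propositional as Related
open import Relation.Binary.Definitions using (tri<; tri≈; tri>)
open import Relation.Binary.PropositionalEquality
open import Relation.Nullary using (¬_; contradiction)
import Relation.Nullary as Nullary
open import Relation.Unary using (Irrelevant)
open import Algebra.Properties.AbelianGroup ℤ.+-0-abelianGroup using (∙-cancelˡ)

open import Defs

private variable
  A : Set
  P R : A → Set

Σ-≡-irrelevant : Irrelevant P → {s s′ : Σ A P} → proj₁ s ≡ proj₁ s′ → s ≡ s′
Σ-≡-irrelevant irr {x , p} {.x , p′} refl = cong (x ,_) (irr p p′)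

×-irrelevant : {B : Set} → Nullary.Irrelevant A → Nullary.Irrelevant B → Nullary.Irrelevant (A × B)
×-irrelevant irrA irrB (a , b) (a′ , b′) = cong₂ _,_ (irrA a a′) (irrB b b′)

Σ-↔-⇔ : Irrelevant P → Irrelevant R → (∀ {x} → P x ⇔ R x) → Σ A P ↔ Σ A R
Σ-↔-⇔ irrP irrR P⇔R = mk↔ₛ′
  (λ (x , p) → x , Equivalence.to P⇔R p)
  (λ (x , r) → x , Equivalence.from P⇔R r)
  (λ _ → Σ-≡-irrelevant irrR refl)
  (λ _ → Σ-≡-irrelevant irrP refl)

Σ-Fin-suc↔ : ∀ {n} {P : Fin (ℕ.suc n) → Set} → Σ (Fin (ℕ.suc n)) P ↔ (P zero ⊎ Σ (Fin n) (P ∘ suc))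
Σ-Fin-suc↔ = mk↔ₛ′
  (λ { (zero , p) → inj₁ p ; (suc j , p) → inj₂ (j , p) })
  (λ { (inj₁ p) → zero , p ; (inj₂ (j , p)) → suc j , p })
  (λ { (inj₁ p) → refl ; (inj₂ (j , p)) → refl })
  (λ { (zero , p) → refl ; (suc j , p) → refl })

interval↔Fin : (m k : ℕ) → Σ ℤ (λ i → + m ≤ i × i < + (m ℕ.+ k)) ↔ Fin k
interval↔Fin m k = mk↔ₛ′ to from to∘from from∘to
  where
  to : Σ ℤ (λ i → + m ≤ i × i < + (m ℕ.+ k)) → Fin k
  to (+ l , +≤+ m≤l , +<+ l<m+k) =
    fromℕ< (ℕ.+-cancelˡ-< m _ _ (subst (ℕ._< m ℕ.+ k) (sym (ℕ.m+[n∸m]≡n m≤l)) l<m+k))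
  from : Fin k → Σ ℤ (λ i → + m ≤ i × i < + (m ℕ.+ k))
  from f = + (m ℕ.+ toℕ f) , +≤+ (ℕ.m≤m+n m (toℕ f)) , +<+ (ℕ.+-monoʳ-< m (toℕ<n f))
  to∘from : ∀ f → to (from f) ≡ f
  to∘from f = toℕ-injective (trans (toℕ-fromℕ< _) (ℕ.m+n∸m≡n m (toℕ f)))
  from∘to : ∀ s → from (to s) ≡ s
  from∘to (+ l , +≤+ m≤l , +<+ _) = Σ-≡-irrelevant (×-irrelevant ℤ.≤-irrelevant ℤ.<-irrelevant)
    (cong +_ (trans (cong (m ℕ.+_) (toℕ-fromℕ< _)) (ℕ.m+[n∸m]≡n m≤l)))

n*i+j<n*m⇔i<m : ∀ {n j} → j ℕ.< n → ∀ i m → (+ n * i + + j < + n * m) ⇔ (i < m)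
n*i+j<n*m⇔i<m {n} {j} j<n i m = mk⇔ cancel bound
  where
  cancel : + n * i + + j < + n * m → i < m
  cancel lt = ℤ.*-cancelˡ-<-nonNeg (+ n) (ℤ.≤-<-trans (ℤ.i≤i+j (+ n * i) (+ j)) lt)
  bound : i < m → + n * i + + j < + n * m
  bound i<m = begin-strict
    + n * i + + j       <⟨ ℤ.+-monoʳ-< (+ n * i) (+<+ j<n) ⟩
    + n * i + + n       ≡⟨ distrib (+ n) i ⟩
    + n * (1ℤ + i)      ≤⟨ ℤ.*-monoˡ-≤-nonNeg (+ n) (ℤ.i<j⇒suc[i]≤j i<m) ⟩
    + n * m             ∎
    where
    open ℤ.≤-Reasoning
    distrib : ∀ x y → x * y + x ≡ x * (1ℤ + y)
    distrib = solve-∀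

module Residues (n : ℕ) .{{_ : NonZero n}} where

  quot : ℤ → ℤ
  quot z = z /ℕ n

  rem : ℤ → Fin n
  rem z = fromℕ< (n%ℕd<d z n)

  quot-rem : ∀ z → + n * quot z + + toℕ (rem z) ≡ z
  quot-rem z = begin
    + n * quot z + + toℕ (rem z)   ≡⟨ cong₂ _+_ (ℤ.*-comm (+ n) (quot z)) (cong +_ (toℕ-fromℕ< _)) ⟩
    quot z * + n + + (z %ℕ n)      ≡⟨ ℤ.+-comm (quot z * + n) _ ⟩
    + (z %ℕ n) + quot z * + n      ≡⟨ sym (a≡a%ℕn+[a/ℕn]*n z n) ⟩
    z                              ∎
    where open ≡-Reasoning

  n*i+j<n*i′+j′ : ∀ {i i′} (j j′ : Fin n) → i < i′ → + n * i + + toℕ j < + n * i′ + + toℕ j′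
  n*i+j<n*i′+j′ {i} {i′} j j′ i<i′ = ℤ.<-≤-trans
    (Equivalence.from (n*i+j<n*m⇔i<m (toℕ<n j) i i′) i<i′) (ℤ.i≤i+j (+ n * i′) (+ toℕ j′))

  divMod-unique : ∀ {i i′} (j j′ : Fin n) → + n * i + + toℕ j ≡ + n * i′ + + toℕ j′ → i ≡ i′ × j ≡ j′
  divMod-unique {i} {i′} j j′ e with ℤ.<-cmp i i′
  ... | tri< i<i′ _ _ = contradiction e (ℤ.<⇒≢ (n*i+j<n*i′+j′ j j′ i<i′))
  ... | tri> _ _ i′<i = contradiction (sym e) (ℤ.<⇒≢ (n*i+j<n*i′+j′ j′ j i′<i))
  ... | tri≈ _ refl _ = refl , toℕ-injective (ℤ.+-injective (∙-cancelˡ (+ n * i) _ _ e))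

  divMod-inverse : ∀ i j → quot (+ n * i + + toℕ j) ≡ i × rem (+ n * i + + toℕ j) ≡ j
  divMod-inverse i j = divMod-unique (rem (+ n * i + + toℕ j)) j (quot-rem (+ n * i + + toℕ j))

-- (u , w) stands for the point (u , c u + N w) of the lattice {(u , v) : v ≡ c u (mod N)}.
LatticePts : (ℤ → Set) → ℤ → ℤ → Set
LatticePts P c N = Σ (ℤ × ℤ) λ uw → P (proj₁ uw) × P (c * proj₁ uw + N * proj₂ uw)

module Fibres (n : ℕ) .{{_ : NonZero n}} (c : ℤ) where
  open Residues n

  Fibre : (ℤ → Set) → Fin n → Set
  Fibre P j = Σ ℤ λ i → P (+ n * i + + toℕ j)

  ρ : Fin n → Fin n
  ρ j = rem (c * + toℕ j)

  offset : Fin n → ℤ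
  offset j = quot (c * + toℕ j)

  lattice-coordinates : ∀ i j w →
    c * (+ n * i + + toℕ j) + + n * w ≡ + n * (c * i + w + offset j) + + toℕ (ρ j)
  lattice-coordinates i j w = begin
    c * (+ n * i + + toℕ j) + + n * w                   ≡⟨ expand c (+ n) i (+ toℕ j) w ⟩
    + n * (c * i + w) + c * + toℕ j                     ≡⟨ cong (_+_ (+ n * (c * i + w))) (sym (quot-rem _)) ⟩
    + n * (c * i + w) + (+ n * offset j + + toℕ (ρ j))  ≡⟨ collect (+ n) (c * i + w) (offset j) (+ toℕ (ρ j)) ⟩
    + n * (c * i + w + offset j) + + toℕ (ρ j)          ∎
    where
    open ≡-Reasoning
    expand : ∀ c n i j w → c * (n * i + j) + n * w ≡ n * (c * i + w) + c * j
    expand = solve-∀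
    collect : ∀ n x s r → n * x + (n * s + r) ≡ n * (x + s) + r
    collect = solve-∀

  shift-unshift : ∀ x k s → x + (k - x - s) + s ≡ k
  shift-unshift = solve-∀

  unshift-shift : ∀ x w s → x + w + s - x - s ≡ w
  unshift-shift = solve-∀

  FibrePairs : (ℤ → Set) → Set
  FibrePairs P = Σ (Fin n) λ j → Fibre P j × Fibre P (ρ j)

  module _ {P : ℤ → Set} (irr : Irrelevant P) where

    fibrePairs-≡ : ∀ {j j′ i i′ k k′ pi pi′ pk pk′} → j ≡ j′ → i ≡ i′ → k ≡ k′ →
      _≡_ {A = FibrePairs P} (j , (i , pi) , (k , pk)) (j′ , (i′ , pi′) , (k′ , pk′))
    fibrePairs-≡ {pi = pi} {pi′} {pk = pk} {pk′ = pk′} refl refl refl =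
      cong₂ (λ pi pk → _ , (_ , pi) , (_ , pk)) (irr pi pi′) (irr pk pk′)

    lattice↔fibres : LatticePts P c (+ n) ↔ FibrePairs P
    lattice↔fibres = mk↔ₛ′ to from to∘from from∘to
      where
      to : LatticePts P c (+ n) → FibrePairs P
      to ((u , w) , pu , pv) = j , (i , subst P (sym (quot-rem u)) pu) , (c * i + w + offset j , subst P eq pv)
        where
        i = quot u
        j = rem u
        eq : c * u + + n * w ≡ + n * (c * i + w + offset j) + + toℕ (ρ j)
        eq = trans (cong (λ z → c * z + + n * w) (sym (quot-rem u))) (lattice-coordinates i j w)
      from : FibrePairs P → LatticePts P c (+ n)
      from (j , (i , pi) , (k , pk)) = (+ n * i + + toℕ j , k - c * i - offset j) , pi , subst P (sym eq) pk
        where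
        eq : c * (+ n * i + + toℕ j) + + n * (k - c * i - offset j) ≡ + n * k + + toℕ (ρ j)
        eq = trans (lattice-coordinates i j (k - c * i - offset j)) (cong (λ z → + n * z + + toℕ (ρ j)) (shift-unshift (c * i) k (offset j)))
      to∘from : ∀ s → to (from s) ≡ s
      to∘from (j , (i , _) , (k , _)) = fibrePairs-≡ rem≡j quot≡i (begin
          c * quot u + (k - c * i - offset j) + offset (rem u)
            ≡⟨ cong₂ (λ i′ j′ → c * i′ + (k - c * i - offset j) + offset j′) quot≡i rem≡j ⟩
          c * i + (k - c * i - offset j) + offset j
            ≡⟨ shift-unshift (c * i) k (offset j) ⟩
          k ∎)
        where
        open ≡-Reasoning
        u = + n * i + + toℕ j
        quot≡i = proj₁ (divMod-inverse i j)
        rem≡j = proj₂ (divMod-inverse i j)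
      from∘to : ∀ s → from (to s) ≡ s
      from∘to ((u , w) , _) = Σ-≡-irrelevant (×-irrelevant irr irr)
        (cong₂ _,_ (quot-rem u) (unshift-shift (c * quot u) w (offset (rem u))))

i≤j-1⇔i<j : ∀ {i j} → (i ≤ j - + 1) ⇔ (i < j)
i≤j-1⇔i<j {i} {j} = subst (λ k → (i ≤ k) ⇔ (i < j)) (ℤ.+-comm -1ℤ j) (mk⇔ ℤ.i≤pred[j]⇒i<j ℤ.i<j⇒i≤pred[j])

Box : ℕ → ℤ → ℤ → Set
Box t N = InInterval (+ 1) (+ t * N - + 1)

box-irrelevant : ∀ t N → Irrelevant (Box t N)
box-irrelevant t N = ×-irrelevant ℤ.≤-irrelevant ℤ.≤-irrelevant

module _ {n : ℕ} .{{_ : NonZero n}} where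

  box-upper : ∀ {j} → j ℕ.< n → ∀ t i → (+ n * i + + j ≤ + t * + n - + 1) ⇔ (i < + t)
  box-upper {j} j<n t i = mk⇔
    (λ h → Equivalence.to floor (subst (_ <_) (ℤ.*-comm (+ t) (+ n)) (Equivalence.to i≤j-1⇔i<j h)))
    (λ h → Equivalence.from i≤j-1⇔i<j (subst (_ <_) (ℤ.*-comm (+ n) (+ t)) (Equivalence.from floor h)))
    where floor = n*i+j<n*m⇔i<m j<n i (+ t)

  box-lower-zero : ∀ i → (+ 1 ≤ + n * i + + 0) ⇔ (+ 1 ≤ i)
  box-lower-zero i = mk⇔
    (λ 1≤ni → ℤ.i<j⇒suc[i]≤j (ℤ.≰⇒> (λ i≤0 → +1≰0 (ℤ.≤-trans 1≤ni (nonPositive i≤0)))))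
    (λ 1≤i → subst (+ 1 ≤_) (sym (ℤ.+-identityʳ (+ n * i)))
      (ℤ.≤-trans (+≤+ (ℕ.>-nonZero⁻¹ n)) (subst (_≤ + n * i) (ℤ.*-identityʳ (+ n)) (ℤ.*-monoˡ-≤-nonNeg (+ n) 1≤i))))
    where
    +1≰0 : ¬ (+ 1 ≤ 0ℤ)
    +1≰0 (+≤+ ())
    nonPositive : i ≤ 0ℤ → + n * i + + 0 ≤ 0ℤ
    nonPositive i≤0 = subst₂ _≤_ (sym (ℤ.+-identityʳ (+ n * i))) (ℤ.*-zeroʳ (+ n)) (ℤ.*-monoˡ-≤-nonNeg (+ n) i≤0)

  box-lower-pos : ∀ {j} → 0 ℕ.< j → j ℕ.< n → ∀ i → (+ 1 ≤ + n * i + + j) ⇔ (+ 0 ≤ i)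
  box-lower-pos {j} 0<j j<n i = mk⇔
    (λ 1≤ni+j → ℤ.≮⇒≥ (λ i<0 → +1≮0 (ℤ.≤-<-trans 1≤ni+j (negative i<0))))
    (λ 0≤i → ℤ.+-mono-≤ (subst (_≤ + n * i) (ℤ.*-zeroʳ (+ n)) (ℤ.*-monoˡ-≤-nonNeg (+ n) 0≤i)) (+≤+ 0<j))
    where
    +1≮0 : ¬ (+ 1 < 0ℤ)
    +1≮0 (+<+ ())
    negative : i < 0ℤ → + n * i + + j < 0ℤ
    negative i<0 = subst (+ n * i + + j <_) (ℤ.*-zeroʳ (+ n)) (Equivalence.from (n*i+j<n*m⇔i<m j<n i 0ℤ) i<0)

module Count (n′ t′ : ℕ) (c d m : ℤ) (inverse : d * c ≡ + 1 + + ℕ.suc n′ * m) where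
  n t : ℕ
  n = ℕ.suc n′
  t = ℕ.suc t′

  open Residues n
  open Fibres n c

  ρ-zero : ρ zero ≡ zero
  ρ-zero = trans (cong rem (c*0≡n*0+0 c (+ n))) (proj₂ (divMod-inverse 0ℤ zero))
    where
    c*0≡n*0+0 : ∀ c n → c * 0ℤ ≡ n * 0ℤ + 0ℤ
    c*0≡n*0+0 = solve-∀

  ρ-suc≢zero : ∀ j → ρ (suc j) ≢ zero
  -- If n divides c j then it divides j = d (c j) - n m j.
  ρ-suc≢zero j ρj≡0 = 0≢1+n (sym (proj₂ (divMod-unique {0ℤ} {d * s - m * x} (suc j) zero eq)))
    where
    open ≡-Reasoning
    x = + toℕ (suc j)
    s = offset (suc j)
    eq : + n * 0ℤ + x ≡ + n * (d * s - m * x) + + toℕ (zero {n′})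
    eq = begin
      + n * 0ℤ + x                                ≡⟨ unfold (+ n) m x ⟩
      (+ 1 + + n * m) * x - + n * m * x          ≡⟨ cong (λ e → e * x - + n * m * x) (sym inverse) ⟩
      d * c * x - + n * m * x                    ≡⟨ cong (_- + n * m * x) (ℤ.*-assoc d c x) ⟩
      d * (c * x) - + n * m * x                  ≡⟨ cong (λ e → d * e - + n * m * x) (sym (quot-rem (c * x))) ⟩
      d * (+ n * s + + toℕ (ρ (suc j))) - + n * m * x  ≡⟨ cong (λ r → d * (+ n * s + + toℕ r) - + n * m * x) ρj≡0 ⟩
      d * (+ n * s + 0ℤ) - + n * m * x            ≡⟨ fold (+ n) d m s x ⟩
      + n * (d * s - m * x) + 0ℤ                  ∎
      where
      unfold : ∀ n m x → n * 0ℤ + x ≡ (+ 1 + n * m) * x - n * m * x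
      unfold = solve-∀
      fold : ∀ n d m s x → d * (n * s + 0ℤ) - n * m * x ≡ n * (d * s - m * x) + 0ℤ
      fold = solve-∀

  fibre-zero : Fibre (Box t (+ n)) zero ↔ Fin t′
  fibre-zero = ↔-trans
    (Σ-↔-⇔ (box-irrelevant t (+ n)) (×-irrelevant ℤ.≤-irrelevant ℤ.<-irrelevant)
      (λ {i} → box-lower-zero {n} i ×-⇔ box-upper (ℕ.s≤s ℕ.z≤n) t i))
    (interval↔Fin 1 t′)

  fibre-suc : ∀ j → Fibre (Box t (+ n)) (suc j) ↔ Fin t
  fibre-suc j = ↔-trans
    (Σ-↔-⇔ (box-irrelevant t (+ n)) (×-irrelevant ℤ.≤-irrelevant ℤ.<-irrelevant)
      (λ {i} → box-lower-pos (ℕ.s≤s ℕ.z≤n) (toℕ<n (suc j)) i ×-⇔ box-upper (toℕ<n (suc j)) t i))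
    (interval↔Fin 0 t)

  fibre-nonzero : ∀ j → j ≢ zero → Fibre (Box t (+ n)) j ↔ Fin t
  fibre-nonzero zero    j≢0 = contradiction refl j≢0
  fibre-nonzero (suc j) _   = fibre-suc j

  lattice-count : LatticePts (Box t (+ n)) c (+ n) ↔ Fin (t′ ℕ.* t′ ℕ.+ n′ ℕ.* (t ℕ.* t))
  lattice-count = begin
    LatticePts (Box t (+ n)) c (+ n)                          ↔⟨ lattice↔fibres (box-irrelevant t (+ n)) ⟩
    FibrePairs (Box t (+ n))                                  ↔⟨ Σ-Fin-suc↔ ⟩
    ((F zero × F (ρ zero)) ⊎ Σ (Fin n′) λ j → F (suc j) × F (ρ (suc j)))
      ↔⟨ (fibre-zero ×-↔ subst (λ j → F j ↔ Fin t′) (sym ρ-zero) fibre-zero)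
         ⊎-↔ Σ.congˡ (fibre-suc _ ×-↔ fibre-nonzero _ (ρ-suc≢zero _)) ⟩
    ((Fin t′ × Fin t′) ⊎ (Fin n′ × (Fin t × Fin t)))          ↔⟨ *↔× ⊎-↔ (↔-refl ×-↔ *↔×) ⟨
    (Fin (t′ ℕ.* t′) ⊎ (Fin n′ × Fin (t ℕ.* t)))              ↔⟨ ↔-refl ⊎-↔ *↔× ⟨
    (Fin (t′ ℕ.* t′) ⊎ Fin (n′ ℕ.* (t ℕ.* t)))                ↔⟨ +↔⊎ ⟨
    Fin (t′ ℕ.* t′ ℕ.+ n′ ℕ.* (t ℕ.* t))                      ∎
    where
    open Related.EquationalReasoning
    F : Fin n → Set
    F = Fibre (Box t (+ n))

module Unimodular (a b p q : ℤ) (bézout : a * p + b * q ≡ + 1) where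

  c N : ℤ
  c = a * q - b * p
  N = a * a + b * b

  coords : ℤ × ℤ → ℤ × ℤ
  coords (x , y) = a * x + b * y , - q * x + p * y

  point : ℤ × ℤ → ℤ × ℤ
  point (u , w) = p * u - b * w , q * u + a * w

  bézout-scale : ∀ z → (a * p + b * q) * z ≡ z
  bézout-scale z = trans (cong (_* z) bézout) (ℤ.*-identityˡ z)

  point∘coords : ∀ xy → point (coords xy) ≡ xy
  point∘coords (x , y) = cong₂ _,_
    (trans (first a b p q x y) (bézout-scale x)) (trans (second a b p q x y) (bézout-scale y))
    where
    first : ∀ a b p q x y → p * (a * x + b * y) - b * (- q * x + p * y) ≡ (a * p + b * q) * x
    first = solve-∀
    second : ∀ a b p q x y → q * (a * x + b * y) + a * (- q * x + p * y) ≡ (a * p + b * q) * y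
    second = solve-∀

  coords∘point : ∀ uw → coords (point uw) ≡ uw
  coords∘point (u , w) = cong₂ _,_
    (trans (first a b p q u w) (bézout-scale u)) (trans (second a b p q u w) (bézout-scale w))
    where
    first : ∀ a b p q u w → a * (p * u - b * w) + b * (q * u + a * w) ≡ (a * p + b * q) * u
    first = solve-∀
    second : ∀ a b p q u w → - q * (p * u - b * w) + p * (q * u + a * w) ≡ (a * p + b * q) * w
    second = solve-∀

  point-v≡cu+Nw : ∀ uw → let (x , y) = point uw in a * y - b * x ≡ c * proj₁ uw + N * proj₂ uw
  point-v≡cu+Nw (u , w) = expand a b p q u w
    where
    expand : ∀ a b p q u w → a * (q * u + a * w) - b * (p * u - b * w) ≡ (a * q - b * p) * u + (a * a + b * b) * w
    expand = solve-∀

  rotated↔lattice : ∀ {P : ℤ → Set} → Irrelevant P →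
    (Σ (ℤ × ℤ) λ xy → P (a * proj₁ xy + b * proj₂ xy) × P (a * proj₂ xy - b * proj₁ xy)) ↔ LatticePts P c N
  rotated↔lattice {P} irr = mk↔ₛ′
    (λ (xy , pu , pv) → coords xy , pu , subst P (trans (cong (λ (x , y) → a * y - b * x) (sym (point∘coords xy))) (point-v≡cu+Nw (coords xy))) pv)
    (λ (uw , pu , pv) → point uw , subst P (sym (cong proj₁ (coords∘point uw))) pu , subst P (sym (point-v≡cu+Nw uw)) pv)
    (λ (uw , _) → Σ-≡-irrelevant (×-irrelevant irr irr) (coords∘point uw))
    (λ (xy , _) → Σ-≡-irrelevant (×-irrelevant irr irr) (point∘coords xy))

  -c*c≡1+N*-[p²+q²] : - c * c ≡ + 1 + N * - (p * p + q * q)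
  -c*c≡1+N*-[p²+q²] = begin
    - c * c                                                   ≡⟨ two-squares a b p q ⟩
    (a * p + b * q) * (a * p + b * q) + N * - (p * p + q * q) ≡⟨ cong (λ e → e * e + N * - (p * p + q * q)) bézout ⟩
    + 1 + N * - (p * p + q * q)                               ∎
    where
    open ≡-Reasoning
    two-squares : ∀ a b p q → - (a * q - b * p) * (a * q - b * p) ≡
      (a * p + b * q) * (a * p + b * q) + (a * a + b * b) * - (p * p + q * q)
    two-squares = solve-∀

sign-factor : ∀ i → Σ ℤ λ s → s * i ≡ + ∣ i ∣
sign-factor (+ m)    = + 1 , ℤ.*-identityˡ (+ m)
sign-factor -[1+ m ] = -1ℤ , cong (λ k → + ℕ.suc k) (ℕ.+-identityʳ m)

bézout-from-ℕ : ∀ a b x y → 1 ℕ.+ y ℕ.* ∣ b ∣ ≡ x ℕ.* ∣ a ∣ → Σ ℤ λ p → Σ ℤ λ q → a * p + b * q ≡ + 1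
bézout-from-ℕ a b x y eq with sign-factor a | sign-factor b
... | sa , sa*a≡∣a∣ | sb , sb*b≡∣b∣ = sa * + x , - (sb * + y) , (begin
  a * (sa * + x) + b * - (sb * + y)   ≡⟨ regroup a b sa sb (+ x) (+ y) ⟩
  (sa * a) * + x - (sb * b) * + y     ≡⟨ cong₂ (λ A B → A * + x - B * + y) sa*a≡∣a∣ sb*b≡∣b∣ ⟩
  + ∣ a ∣ * + x - + ∣ b ∣ * + y       ≡⟨ cong₂ _-_ (ℤ.*-comm (+ ∣ a ∣) (+ x)) (ℤ.*-comm (+ ∣ b ∣) (+ y)) ⟩
  + x * + ∣ a ∣ - + y * + ∣ b ∣       ≡⟨ cong (_- + y * + ∣ b ∣) (sym eqℤ) ⟩
  + 1 + + y * + ∣ b ∣ - + y * + ∣ b ∣ ≡⟨ cancel (+ y * + ∣ b ∣) ⟩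
  + 1                                 ∎)
  where
  open ≡-Reasoning
  regroup : ∀ a b sa sb x y → a * (sa * x) + b * - (sb * y) ≡ (sa * a) * x - (sb * b) * y
  regroup = solve-∀
  cancel : ∀ z → + 1 + z - z ≡ + 1
  cancel = solve-∀
  eqℤ : + 1 + + y * + ∣ b ∣ ≡ + x * + ∣ a ∣
  eqℤ = begin
    + 1 + + y * + ∣ b ∣      ≡⟨ cong (_+_ (+ 1)) (ℤ.pos-* y ∣ b ∣) ⟨
    + 1 + + (y ℕ.* ∣ b ∣)    ≡⟨ ℤ.pos-+ 1 (y ℕ.* ∣ b ∣) ⟨
    + (1 ℕ.+ y ℕ.* ∣ b ∣)    ≡⟨ cong +_ eq ⟩
    + (x ℕ.* ∣ a ∣)          ≡⟨ ℤ.pos-* x ∣ a ∣ ⟩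
    + x * + ∣ a ∣            ∎

bézout : ∀ a b → gcd a b ≡ + 1 → Σ ℤ λ p → Σ ℤ λ q → a * p + b * q ≡ + 1
bézout a b gcd≡1 with Bézout.identity (subst (GCD ∣ a ∣ ∣ b ∣) (ℤ.+-injective gcd≡1) (gcd-GCD ∣ a ∣ ∣ b ∣))
... | Bézout.+- x y eq = bézout-from-ℕ a b x y eq
... | Bézout.-+ x y eq with bézout-from-ℕ b a y x eq
...   | q , p , bq+ap≡1 = p , q , trans (ℤ.+-comm (a * p) (b * q)) bq+ap≡1

square≡∣∣² : ∀ i → i * i ≡ + (∣ i ∣ ℕ.* ∣ i ∣)
square≡∣∣² (+ m)    = sym (ℤ.pos-* m m)
square≡∣∣² -[1+ m ] = refl

sum-of-squares≡ : ∀ a b → a * a + b * b ≡ + (∣ a ∣ ℕ.* ∣ a ∣ ℕ.+ ∣ b ∣ ℕ.* ∣ b ∣)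
sum-of-squares≡ a b = trans (cong₂ _+_ (square≡∣∣² a) (square≡∣∣² b)) (sym (ℤ.pos-+ (∣ a ∣ ℕ.* ∣ a ∣) (∣ b ∣ ℕ.* ∣ b ∣)))

sum-of-squares-pos : ∀ {a b p q} → a * p + b * q ≡ + 1 → Σ ℕ λ n′ → a * a + b * b ≡ + ℕ.suc n′
sum-of-squares-pos {+ 0}        {+ 0}        ()
sum-of-squares-pos {+ ℕ.suc m}  {b}          _ = _ , sum-of-squares≡ (+ ℕ.suc m) b
sum-of-squares-pos { -[1+ m ]}  {b}          _ = _ , sum-of-squares≡ -[1+ m ] b
sum-of-squares-pos {+ 0}        {+ ℕ.suc m}  _ = _ , sum-of-squares≡ (+ 0) (+ ℕ.suc m)
sum-of-squares-pos {+ 0}        { -[1+ m ]}  _ = _ , sum-of-squares≡ (+ 0) -[1+ m ]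

count-formula : ∀ n′ t′ → let t = ℕ.suc t′ in
  + (t′ ℕ.* t′ ℕ.+ n′ ℕ.* (t ℕ.* t)) ≡ + ℕ.suc n′ * + t * + t - + 2 * + t + + 1
count-formula n′ t′ = begin
  + (t′ ℕ.* t′ ℕ.+ n′ ℕ.* (t ℕ.* t))       ≡⟨ ℤ.pos-+ (t′ ℕ.* t′) (n′ ℕ.* (t ℕ.* t)) ⟩
  + (t′ ℕ.* t′) + + (n′ ℕ.* (t ℕ.* t))     ≡⟨ cong₂ _+_ (ℤ.pos-* t′ t′) (trans (ℤ.pos-* n′ (t ℕ.* t)) (cong (+ n′ *_) (ℤ.pos-* t t))) ⟩
  + t′ * + t′ + + n′ * (+ t * + t)         ≡⟨ expand (+ n′) (+ t′) ⟩
  + ℕ.suc n′ * + t * + t - + 2 * + t + + 1 ∎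
  where
  t = ℕ.suc t′
  open ≡-Reasoning
  expand : ∀ n t → t * t + n * ((+ 1 + t) * (+ 1 + t)) ≡ (+ 1 + n) * (+ 1 + t) * (+ 1 + t) - + 2 * (+ 1 + t) + + 1
  expand = solve-∀

points↔Fin : ∀ a b {p q} → a * p + b * q ≡ + 1 → ∀ {n′} → a * a + b * b ≡ + ℕ.suc n′ → ∀ t′ →
  Pts a b (ℕ.suc t′) ↔ Fin (t′ ℕ.* t′ ℕ.+ n′ ℕ.* (ℕ.suc t′ ℕ.* ℕ.suc t′))
points↔Fin a b {p} {q} bez {n′} N≡n t′ = ↔-trans
  (rotated↔lattice (box-irrelevant t N))
  (subst (λ N → LatticePts (Box t N) c N ↔ Fin _) (sym N≡n)
    (Count.lattice-count n′ t′ c (- c) (- (p * p + q * q)) (subst (λ N → - c * c ≡ + 1 + N * _) N≡n -c*c≡1+N*-[p²+q²])))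
  where
  t = ℕ.suc t′
  open Unimodular a b p q bez

proposition2p1 : (a b : ℤ) → gcd a b ≡ + 1 → (t : ℕ) → 1 ℕ.≤ t →
    Σ ℕ λ N → (+ N ≡ (a * a + b * b) * (+ t) * (+ t) - + 2 * + t + + 1) × (Pts a b t ↔ Fin N)
proposition2p1 a b gcd≡1 (ℕ.suc t′) _ with bézout a b gcd≡1
... | p , q , bez with sum-of-squares-pos {a} {b} bez
... | n′ , N≡n = _ ,
  trans (count-formula n′ t′) (cong (λ N → N * + ℕ.suc t′ * + ℕ.suc t′ - + 2 * + ℕ.suc t′ + + 1) (sym N≡n)) ,
  points↔Fin a b bez N≡n t′
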